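{- For every alphabet $\Sigma=\{1,2,\dots,\sigma\}$ there exists an infinite family of strings over $\Sigma$ with the following properties. Each string has length $n=k\sigma$ for some integer $k$. Each string contains $\Omega(\sigma n)$ fragments that are order-preserving squares and that are pairwise distinct as words. The constant hidden in $\Omega$ is absolute.
   Context: Two strings $u,v$ over an ordered alphabet are order-isomorphic, written $u\approx v$, if $|u|=|v|$ and for all $i,j$ we have $u[i]\le u[j]$ iff $v[i]\le v[j]$. An order-preserving square is a string $uv$ with $u\approx v$ and $u\neq v$. Two order-preserving squares are distinct as words if they are different strings. -}

module Defs where

open import Data.Nat using (ℕ; _≤_)
open import Data.Fin using (Fin; toℕ; cast)
open import Data.List using (List; length; lookup; _++_)
open import Data.Product using (Σ; ∃; _×_)
open import Function.Bundles using (_⇔_)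
open import Relation.Binary.PropositionalEquality using (_≡_; _≢_)

-- Strings over the alphabet Σ = {1,…,σ} are lists over Fin σ
-- (letter i ∈ Fin σ stands for i+1; order is the order of toℕ).
Word : ℕ → Set
Word σ = List (Fin σ)

OrderIso : ∀ {σ} → Word σ → Word σ → Set
OrderIso u v =
  Σ (length u ≡ length v) λ eq →
    ∀ (i j : Fin (length u)) →
      (toℕ (lookup u i) ≤ toℕ (lookup u j))
        ⇔ (toℕ (lookup v (cast eq i)) ≤ toℕ (lookup v (cast eq j)))

OPSquare : ∀ {σ} → Word σ → Set
OPSquare {σ} w = Σ (Word σ) λ u → Σ (Word σ) λ v →
  (w ≡ u ++ v) × OrderIso u v × (u ≢ v)

Fragment : ∀ {σ} → Word σ → Word σ → Set
Fragment {σ} w s = Σ (Word σ) λ x → Σ (Word σ) λ y → s ≡ x ++ (w ++ y)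

{-# OPTIONS --safe #-}

-- The witness is the staircase 0^k 1^k ⋯ (σ−1)^k of length n = σk. Moving a window by j
-- whole blocks raises each of its letters by exactly j, so every factor of length 2jk is an
-- order-preserving square. With q = ⌊σ/4⌋, taking 1 ≤ j ≤ q and start positions below 2qk
-- gives 2q²k ≥ σn/32 squares. They are distinct: the length separates different j, and for
-- a fixed length ≥ k, sliding the window one step to the right strictly increases its
-- letter sum. For σ ≤ 3 the k squares 0^m 1^m around the first block boundary suffice.

module Submission where

open import Defs
open import Data.Nat using (ℕ; zero; suc; pred; _+_; _*_; _∸_; _⊓_; _≤_; _<_; z≤n; s≤s; s≤s⁻¹; s<s; NonZero; >-nonZero⁻¹)
open import Data.Nat.Properties
open import Data.Nat.DivMod using (_/_; _%_; m≡m%n+[m/n]*n; m%n<n; m/n*n≤m; m<n*o⇒m/o<n; m<n⇒m/n≡0; m≥n⇒m/n>0; m*n/n≡m; +-distrib-/-∣ʳ; /-monoˡ-≤)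
open import Data.Nat.Divisibility using (divides-refl)
open import Data.Nat.ListAction using (sum)
open import Data.Nat.Tactic.RingSolver using (solve-∀)
open import Data.Fin using (Fin; toℕ; fromℕ<; cast) renaming (zero to fzero; suc to fsuc)
open import Data.Fin.Properties using (toℕ-fromℕ<; toℕ-cast; toℕ<n; toℕ-injective)
open import Data.List using (List; []; _∷_; _++_; length; lookup; map; applyUpTo; allFin; cartesianProductWith)
open import Data.List.Properties using (length-++; length-map; length-applyUpTo; length-tabulate; ∷-injectiveˡ)
open import Data.List.Relation.Unary.All using (All)
import Data.List.Relation.Unary.All.Properties as All
open import Data.List.Relation.Unary.Unique.Propositional using (Unique)
import Data.List.Relation.Unary.Unique.Propositional.Properties as Unique
open import Data.Product using (Σ; _×_; _,_; proj₁; proj₂)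
open import Data.Sum using (inj₁; inj₂)
open import Data.Empty using (⊥-elim)
open import Relation.Nullary using (yes; no)
open import Relation.Binary.Definitions using (tri<; tri≈; tri>)
open import Function using (_∘_; id)
open import Function.Bundles using (mk⇔)
open import Relation.Binary.PropositionalEquality using (_≡_; _≢_; refl; sym; trans; cong; subst; subst₂; cong₂; setoid; module ≡-Reasoning)

m+m≡n+n⇒m≡n : ∀ {m n} → m + m ≡ n + n → m ≡ n
m+m≡n+n⇒m≡n {zero}  {zero}  _  = refl
m+m≡n+n⇒m≡n {suc m} {suc n} eq =
  cong suc (m+m≡n+n⇒m≡n (suc-injective (trans (sym (+-suc m m)) (trans (suc-injective eq) (+-suc n n)))))

length-cartesianProductWith : {A B C : Set} (f : A → B → C) (xs : List A) (ys : List B) →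
                              length (cartesianProductWith f xs ys) ≡ length xs * length ys
length-cartesianProductWith f []       ys = refl
length-cartesianProductWith f (x ∷ xs) ys =
  trans (length-++ (map (f x) ys))
        (cong₂ _+_ (length-map (f x) ys) (length-cartesianProductWith f xs ys))

OPSquareIn : ∀ {σ} → Word σ → Word σ → Set
OPSquareIn s w = OPSquare w × Fragment w s

window : {A : Set} → (ℕ → A) → ℕ → ℕ → List A
window f p zero    = []
window f p (suc L) = f p ∷ window f (suc p) L

module _ {A : Set} (f : ℕ → A) where

  length-window : ∀ p L → length (window f p L) ≡ L
  length-window p zero    = refl
  length-window p (suc L) = cong suc (length-window (suc p) L)

  lookup-window : ∀ p L (i : Fin (length (window f p L))) →
                  lookup (window f p L) i ≡ f (p + toℕ i)
  lookup-window p (suc L) fzero    = cong f (sym (+-identityʳ p))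
  lookup-window p (suc L) (fsuc i) =
    trans (lookup-window (suc p) L i) (cong f (sym (+-suc p (toℕ i))))

  window-++ : ∀ p m n → window f p (m + n) ≡ window f p m ++ window f (p + m) n
  window-++ p zero    n = cong (λ p′ → window f p′ n) (sym (+-identityʳ p))
  window-++ p (suc m) n = cong (f p ∷_) (trans (window-++ (suc p) m n)
    (cong (λ p′ → window f (suc p) m ++ window f p′ n) (sym (+-suc p m))))

map-window : {A B : Set} (g : A → B) (f : ℕ → A) → ∀ p L →
             map g (window f p L) ≡ window (g ∘ f) p L
map-window g f p zero    = refl
map-window g f p (suc L) = cong (g (f p) ∷_) (map-window g f (suc p) L)

window-fragment : ∀ {σ} (f : ℕ → Fin σ) {p L n} → p + L ≤ n →
                  Fragment (window f p L) (window f 0 n)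
window-fragment f {p} {L} {n} p+L≤n = window f 0 p , window f (p + L) r , (begin
    window f 0 n                                  ≡⟨ cong (window f 0) (sym p+[L+r]≡n) ⟩
    window f 0 (p + (L + r))                      ≡⟨ window-++ f 0 p (L + r) ⟩
    window f 0 p ++ window f p (L + r)            ≡⟨ cong (window f 0 p ++_) (window-++ f p L r) ⟩
    window f 0 p ++ (window f p L ++ window f (p + L) r) ∎)
  where
  open ≡-Reasoning
  r : ℕ
  r = n ∸ (p + L)
  p+[L+r]≡n : p + (L + r) ≡ n
  p+[L+r]≡n = trans (sym (+-assoc p L r)) (m+[n∸m]≡n p+L≤n)

orderIso-shift : ∀ {σ} (f : ℕ → Fin σ) p q m c →
                 (∀ i → i < m → toℕ (f (q + i)) ≡ toℕ (f (p + i)) + c) →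
                 OrderIso (window f p m) (window f q m)
orderIso-shift f p q m c shift = eq , λ i j → mk⇔
    (λ u≤ → subst₂ _≤_ (sym v[ i ]) (sym v[ j ]) (+-monoˡ-≤ c (subst₂ _≤_ u[ i ] u[ j ] u≤)))
    (λ v≤ → subst₂ _≤_ (sym u[ i ]) (sym u[ j ]) (+-cancelʳ-≤ c _ _ (subst₂ _≤_ v[ i ] v[ j ] v≤)))
  where
  eq : length (window f p m) ≡ length (window f q m)
  eq = trans (length-window f p m) (sym (length-window f q m))
  u[_] : ∀ i → toℕ (lookup (window f p m) i) ≡ toℕ (f (p + toℕ i))
  u[ i ] = cong toℕ (lookup-window f p m i)
  v[_] : ∀ i → toℕ (lookup (window f q m) (cast eq i)) ≡ toℕ (f (p + toℕ i)) + c
  v[ i ] = trans (cong toℕ (lookup-window f q m (cast eq i)))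
    (trans (cong (λ i′ → toℕ (f (q + i′))) (toℕ-cast eq i))
      (shift (toℕ i) (subst (toℕ i <_) (length-window f p m) (toℕ<n i))))

opSquare-shift : ∀ {σ} (f : ℕ → Fin σ) p m c → 0 < m → 0 < c →
                 (∀ i → i < m → toℕ (f (p + m + i)) ≡ toℕ (f (p + i)) + c) →
                 OPSquare (window f p (m + m))
opSquare-shift f p m@(suc _) c _ c>0 shift =
  window f p m , window f (p + m) m , window-++ f p m m ,
  orderIso-shift f p (p + m) m c shift , first-letters-differ
  where
  first-letters-differ : window f p m ≢ window f (p + m) m
  first-letters-differ u≡v = <-irrefl (cong toℕ (∷-injectiveˡ u≡v)) (begin-strict
    toℕ (f p)                ≡⟨ cong (toℕ ∘ f) (sym (+-identityʳ p)) ⟩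
    toℕ (f (p + 0))          <⟨ m<m+n _ c>0 ⟩
    toℕ (f (p + 0)) + c      ≡⟨ sym (shift 0 (s≤s z≤n)) ⟩
    toℕ (f (p + m + 0))      ≡⟨ cong (toℕ ∘ f) (+-identityʳ (p + m)) ⟩
    toℕ (f (p + m))          ∎)
    where open ≤-Reasoning

sum-window-suc : ∀ (h : ℕ → ℕ) p L → sum (window h (suc p) L) + h p ≡ sum (window h p L) + h (p + L)
sum-window-suc h p zero    = cong h (sym (+-identityʳ p))
sum-window-suc h p (suc L) = begin
    (h (suc p) + S₂) + h p         ≡⟨ +-comm _ (h p) ⟩
    h p + (h (suc p) + S₂)         ≡⟨ cong (h p +_) (+-comm (h (suc p)) S₂) ⟩
    h p + (S₂ + h (suc p))         ≡⟨ cong (h p +_) (sum-window-suc h (suc p) L) ⟩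
    h p + (S₁ + h (suc (p + L)))   ≡⟨ sym (+-assoc (h p) S₁ _) ⟩
    (h p + S₁) + h (suc (p + L))   ≡⟨ cong (λ x → (h p + S₁) + h x) (sym (+-suc p L)) ⟩
    (h p + S₁) + h (p + suc L)     ∎
  where
  open ≡-Reasoning
  S₁ S₂ : ℕ
  S₁ = sum (window h (suc p) L)
  S₂ = sum (window h (suc (suc p)) L)

sum-window-< : ∀ (h : ℕ → ℕ) p L → h p < h (p + L) → sum (window h p L) < sum (window h (suc p) L)
sum-window-< h p L hp<hp+L = +-cancelʳ-< (h p) _ _
  (subst (sum (window h p L) + h p <_) (sym (sum-window-suc h p L)) (+-monoʳ-< _ hp<hp+L))

module _ (h : ℕ → ℕ) {P : ℕ} (step : ∀ {i} → suc i < P → h i < h (suc i)) where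

  stepwise-< : ∀ {i j} → i < j → j < P → h i < h j
  stepwise-< {j = suc j} i<1+j 1+j<P with m≤n⇒m<n∨m≡n (s≤s⁻¹ i<1+j)
  ... | inj₂ refl = step 1+j<P
  ... | inj₁ i<j  = <-trans (stepwise-< i<j (<-trans (n<1+n j) 1+j<P)) (step 1+j<P)

  stepwise-injective : ∀ {i j} → i < P → j < P → h i ≡ h j → i ≡ j
  stepwise-injective {i} {j} i<P j<P hi≡hj with <-cmp i j
  ... | tri< i<j _ _ = ⊥-elim (<⇒≢ (stepwise-< i<j j<P) hi≡hj)
  ... | tri≈ _ i≡j _ = i≡j
  ... | tri> _ _ j<i = ⊥-elim (<⇒≢ (stepwise-< j<i i<P) (sym hi≡hj))

module Staircase (σ k : ℕ) .{{_ : NonZero σ}} .{{_ : NonZero k}} where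

  -- ⌊x/k⌋, truncated at σ − 1 so that it is a letter for every x
  letter : ℕ → Fin σ
  letter x = fromℕ< (m≤pred[n]⇒suc[m]≤n (m⊓n≤n (x / k) (pred σ)))

  staircase : Word σ
  staircase = window letter 0 (σ * k)

  toℕ-letter : ∀ x → toℕ (letter x) ≡ x / k ⊓ pred σ
  toℕ-letter x = toℕ-fromℕ< _

  letter-mono : ∀ {x y} → x ≤ y → toℕ (letter x) ≤ toℕ (letter y)
  letter-mono {x} {y} x≤y = subst₂ _≤_ (sym (toℕ-letter x)) (sym (toℕ-letter y))
    (⊓-mono-≤ (/-monoˡ-≤ k x≤y) (≤-refl {pred σ}))

  toℕ-letter-< : ∀ {x} → x < σ * k → toℕ (letter x) ≡ x / k
  toℕ-letter-< {x} x<σk = trans (toℕ-letter x)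
    (m≤n⇒m⊓n≡m (suc[m]≤n⇒m≤pred[n] (m<n*o⇒m/o<n {n = σ} x<σk)))

  toℕ-letter-+* : ∀ x j → x + j * k < σ * k → toℕ (letter (x + j * k)) ≡ toℕ (letter x) + j
  toℕ-letter-+* x j x+jk<σk = begin
    toℕ (letter (x + j * k))  ≡⟨ toℕ-letter-< x+jk<σk ⟩
    (x + j * k) / k           ≡⟨ +-distrib-/-∣ʳ x (divides-refl j) ⟩
    x / k + j * k / k         ≡⟨ cong₂ _+_ (sym (toℕ-letter-< (≤-<-trans (m≤m+n x _) x+jk<σk))) (m*n/n≡m j k) ⟩
    toℕ (letter x) + j        ∎
    where open ≡-Reasoning

  letter-climb : ∀ p L → k ≤ L → p + L < σ * k → toℕ (letter p) < toℕ (letter (p + L))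
  letter-climb p L k≤L p+L<σk = begin-strict
    toℕ (letter p)            <⟨ m<m+n _ (s≤s z≤n) ⟩
    toℕ (letter p) + 1        ≡⟨ sym (toℕ-letter-+* p 1 (≤-<-trans p+k≤p+L p+L<σk)) ⟩
    toℕ (letter (p + 1 * k))  ≤⟨ letter-mono p+k≤p+L ⟩
    toℕ (letter (p + L))      ∎
    where
    open ≤-Reasoning
    p+k≤p+L : p + 1 * k ≤ p + L
    p+k≤p+L = +-monoʳ-≤ p (subst (_≤ L) (sym (*-identityˡ k)) k≤L)

  window-injective : ∀ {P} L → k ≤ L → P + L ≤ σ * k → ∀ {p p′} → p < P → p′ < P →
                     window letter p L ≡ window letter p′ L → p ≡ p′
  window-injective {P} L k≤L P+L≤σk p<P p′<P eq =
    stepwise-injective letterSum climb p<P p′<P (cong (sum ∘ map toℕ) eq)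
    where
    letterSum : ℕ → ℕ
    letterSum p = sum (map toℕ (window letter p L))
    climb : ∀ {i} → suc i < P → letterSum i < letterSum (suc i)
    climb {i} 1+i<P = subst₂ _<_ (cong sum (sym (map-window toℕ letter i L)))
                                 (cong sum (sym (map-window toℕ letter (suc i) L)))
      (sum-window-< (toℕ ∘ letter) i L
        (letter-climb i L k≤L (<-≤-trans (+-monoˡ-< L (<-trans (n<1+n i) 1+i<P)) P+L≤σk)))

  letter-below-k : ∀ {x} → x < k → toℕ (letter x) ≡ 0
  letter-below-k x<k = trans (toℕ-letter-< (<-≤-trans x<k (m≤n*m k σ))) (m<n⇒m/n≡0 x<k)

  module StepSquares (2≤σ : 2 ≤ σ) where

    k+k≤σk : k + k ≤ σ * k
    k+k≤σk = subst (_≤ σ * k) (cong (k +_) (+-identityʳ k)) (*-monoˡ-≤ k 2≤σ)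

    stepSquare : ℕ → Word σ
    stepSquare m = window letter (k ∸ m) (m + m)

    stepSquare-OPSquareIn : ∀ m → 0 < m → m ≤ k → OPSquareIn staircase (stepSquare m)
    stepSquare-OPSquareIn m 0<m m≤k =
      opSquare-shift letter (k ∸ m) m 1 0<m (s≤s z≤n) shift , window-fragment letter fits
      where
      shift : ∀ i → i < m → toℕ (letter (k ∸ m + m + i)) ≡ toℕ (letter (k ∸ m + i)) + 1
      shift i i<m = begin
        toℕ (letter (k ∸ m + m + i))  ≡⟨ cong (λ x → toℕ (letter (x + i))) (m∸n+n≡m m≤k) ⟩
        toℕ (letter (k + i))          ≡⟨ cong (toℕ ∘ letter) k+i≡i+1k ⟩
        toℕ (letter (i + 1 * k))      ≡⟨ toℕ-letter-+* i 1 i+1k<σk ⟩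
        toℕ (letter i) + 1            ≡⟨ cong (_+ 1) (trans (letter-below-k i<k) (sym (letter-below-k k∸m+i<k))) ⟩
        toℕ (letter (k ∸ m + i)) + 1  ∎
        where
        open ≡-Reasoning
        i<k : i < k
        i<k = <-≤-trans i<m m≤k
        k+i≡i+1k : k + i ≡ i + 1 * k
        k+i≡i+1k = trans (+-comm k i) (cong (i +_) (sym (*-identityˡ k)))
        i+1k<σk : i + 1 * k < σ * k
        i+1k<σk = subst (_< σ * k) k+i≡i+1k (<-≤-trans (+-monoʳ-< k i<k) k+k≤σk)
        k∸m+i<k : k ∸ m + i < k
        k∸m+i<k = subst (k ∸ m + i <_) (m∸n+n≡m m≤k) (+-monoʳ-< (k ∸ m) i<m)
      fits : k ∸ m + (m + m) ≤ σ * k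
      fits = begin
        k ∸ m + (m + m)  ≡⟨ sym (+-assoc (k ∸ m) m m) ⟩
        k ∸ m + m + m    ≡⟨ cong (_+ m) (m∸n+n≡m m≤k) ⟩
        k + m            ≤⟨ +-monoʳ-≤ k m≤k ⟩
        k + k            ≤⟨ k+k≤σk ⟩
        σ * k            ∎
        where open ≤-Reasoning

    stepSquares : List (Word σ)
    stepSquares = applyUpTo (stepSquare ∘ suc) k

    stepSquares-unique : Unique stepSquares
    stepSquares-unique = Unique.applyUpTo⁺₁ (stepSquare ∘ suc) k λ i<j _ eq →
      <⇒≢ (+-mono-< (s<s i<j) (s<s i<j))
        (trans (sym (length-window letter _ _)) (trans (cong length eq) (length-window letter _ _)))

    stepSquares-OPSquareIn : All (OPSquareIn staircase) stepSquares
    stepSquares-OPSquareIn = All.applyUpTo⁺₁ (stepSquare ∘ suc) k (stepSquare-OPSquareIn _ (s≤s z≤n))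

    length-stepSquares : length stepSquares ≡ k
    length-stepSquares = length-applyUpTo (stepSquare ∘ suc) k

  module BlockSquares (q P : ℕ) (fits : P + (q * k + q * k) ≤ σ * k) where

    half : Fin q → ℕ
    half j = suc (toℕ j) * k

    blockSquare : Fin q → Fin P → Word σ
    blockSquare j p = window letter (toℕ p) (half j + half j)

    block-fits : ∀ j → P + (half j + half j) ≤ σ * k
    block-fits j = ≤-trans (+-monoʳ-≤ P (+-mono-≤ half≤qk half≤qk)) fits
      where
      half≤qk : half j ≤ q * k
      half≤qk = *-monoˡ-≤ k (toℕ<n j)

    blockSquare-OPSquareIn : ∀ j p → OPSquareIn staircase (blockSquare j p)
    blockSquare-OPSquareIn j p =
      opSquare-shift letter (toℕ p) m (suc (toℕ j)) 0<m (s≤s z≤n) shift ,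
      window-fragment letter p+[m+m]≤σk
      where
      m : ℕ
      m = half j
      0<m : 0 < m
      0<m = <-≤-trans (>-nonZero⁻¹ k) (m≤m+n k _)
      p+[m+m]≤σk : toℕ p + (m + m) ≤ σ * k
      p+[m+m]≤σk = ≤-trans (+-monoˡ-≤ (m + m) (<⇒≤ (toℕ<n p))) (block-fits j)
      shift : ∀ i → i < m → toℕ (letter (toℕ p + m + i)) ≡ toℕ (letter (toℕ p + i)) + suc (toℕ j)
      shift i i<m = trans (cong (toℕ ∘ letter) reorder) (toℕ-letter-+* (toℕ p + i) (suc (toℕ j)) bound)
        where
        reorder : toℕ p + m + i ≡ toℕ p + i + m
        reorder = trans (+-assoc (toℕ p) m i)
                    (trans (cong (toℕ p +_) (+-comm m i)) (sym (+-assoc (toℕ p) i m)))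
        bound : toℕ p + i + m < σ * k
        bound = subst (_< σ * k) reorder (<-≤-trans
          (subst (toℕ p + m + i <_) (+-assoc (toℕ p) m m) (+-monoʳ-< (toℕ p + m) i<m)) p+[m+m]≤σk)

    half-injective : ∀ {j j′} → half j ≡ half j′ → j ≡ j′
    half-injective {j} {j′} eq = toℕ-injective (suc-injective (*-cancelʳ-≡ (suc (toℕ j)) (suc (toℕ j′)) k eq))

    blockSquare-injective : ∀ {j j′ p p′} → blockSquare j p ≡ blockSquare j′ p′ → j ≡ j′ × p ≡ p′
    blockSquare-injective {j} {j′} {p} {p′} eq
      with half-injective {j} {j′} (m+m≡n+n⇒m≡n {half j} {half j′}
             (trans (sym (length-window letter _ _)) (trans (cong length eq) (length-window letter _ _))))
    ... | refl = refl , toℕ-injective (window-injective L k≤L (block-fits j) (toℕ<n p) (toℕ<n p′) eq)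
      where
      L : ℕ
      L = half j + half j
      k≤L : k ≤ L
      k≤L = ≤-trans (m≤m+n k _) (m≤m+n (half j) _)

    blockSquares : List (Word σ)
    blockSquares = cartesianProductWith blockSquare (allFin q) (allFin P)

    blockSquares-unique : Unique blockSquares
    blockSquares-unique = Unique.cartesianProductWith⁺ blockSquare blockSquare-injective
                            (Unique.allFin⁺ q) (Unique.allFin⁺ P)

    blockSquares-OPSquareIn : All (OPSquareIn staircase) blockSquares
    blockSquares-OPSquareIn = All.cartesianProductWith⁺ (setoid (Fin q)) (setoid (Fin P)) blockSquare
                        (allFin q) (allFin P) (λ {j} {p} _ _ → blockSquare-OPSquareIn j p)

    length-blockSquares : length blockSquares ≡ q * P
    length-blockSquares = trans (length-cartesianProductWith blockSquare (allFin q) (allFin P))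
                                (cong₂ _*_ (length-tabulate {n = q} id) (length-tabulate {n = P} id))

quarter-bounds : ∀ σ → 4 ≤ σ → 4 * (σ / 4) ≤ σ × σ ≤ 8 * (σ / 4)
quarter-bounds σ 4≤σ = subst (_≤ σ) (*-comm (σ / 4) 4) (m/n*n≤m σ 4) , (begin
    σ                        ≡⟨ m≡m%n+[m/n]*n σ 4 ⟩
    σ % 4 + σ / 4 * 4        ≤⟨ +-monoˡ-≤ (σ / 4 * 4) (<⇒≤ (<-≤-trans (m%n<n σ 4) (*-monoˡ-≤ 4 (m≥n⇒m/n>0 4≤σ)))) ⟩
    σ / 4 * 4 + σ / 4 * 4    ≡⟨ q*4+q*4≡8*q (σ / 4) ⟩
    8 * (σ / 4)              ∎)
  where
  open ≤-Reasoning
  q*4+q*4≡8*q : ∀ q → q * 4 + q * 4 ≡ 8 * q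
  q*4+q*4≡8*q = solve-∀

σ≤3⇒σ*[σ*k]≤32*k : ∀ {σ} k → σ ≤ 3 → σ * (σ * k) ≤ 32 * k
σ≤3⇒σ*[σ*k]≤32*k {σ} k σ≤3 = begin
    σ * (σ * k)  ≤⟨ *-mono-≤ σ≤3 (*-monoˡ-≤ k σ≤3) ⟩
    3 * (3 * k)  ≡⟨ 3*[3*k]≡9*k k ⟩
    9 * k        ≤⟨ *-monoˡ-≤ k (m≤m+n 9 23) ⟩
    32 * k       ∎
  where
  open ≤-Reasoning
  3*[3*k]≡9*k : ∀ k → 3 * (3 * k) ≡ 9 * k
  3*[3*k]≡9*k = solve-∀

4q≤σ⇒4qk≤σk : ∀ {q σ} k → 4 * q ≤ σ → q * k + q * k + (q * k + q * k) ≤ σ * k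
4q≤σ⇒4qk≤σk {q} {σ} k 4q≤σ = subst (_≤ σ * k) (4*q*k≡qk+qk+[qk+qk] q k) (*-monoˡ-≤ k 4q≤σ)
  where
  4*q*k≡qk+qk+[qk+qk] : ∀ q k → 4 * q * k ≡ q * k + q * k + (q * k + q * k)
  4*q*k≡qk+qk+[qk+qk] = solve-∀

σ≤8q⇒σ*[σ*k]≤32*[q*[qk+qk]] : ∀ {q σ} k → σ ≤ 8 * q → σ * (σ * k) ≤ 32 * (q * (q * k + q * k))
σ≤8q⇒σ*[σ*k]≤32*[q*[qk+qk]] {q} {σ} k σ≤8q = begin
    σ * (σ * k)                 ≤⟨ *-mono-≤ σ≤8q (*-monoˡ-≤ k σ≤8q) ⟩
    8 * q * (8 * q * k)         ≡⟨ 8q*[8q*k]≡32*[q*[qk+qk]] q k ⟩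
    32 * (q * (q * k + q * k))  ∎
  where
  open ≤-Reasoning
  8q*[8q*k]≡32*[q*[qk+qk]] : ∀ q k → 8 * q * (8 * q * k) ≡ 32 * (q * (q * k + q * k))
  8q*[8q*k]≡32*[q*[qk+qk]] = solve-∀

staircase-opSquares : ∀ σ k .{{_ : NonZero σ}} .{{_ : NonZero k}} → 2 ≤ σ →
  Σ (List (Word σ)) λ L → Unique L × All (OPSquareIn (Staircase.staircase σ k)) L ×
    σ * (σ * k) ≤ 32 * length L
staircase-opSquares σ k 2≤σ with σ <? 4
... | yes σ<4 = stepSquares , stepSquares-unique , stepSquares-OPSquareIn ,
                subst (λ n → σ * (σ * k) ≤ 32 * n) (sym length-stepSquares) (σ≤3⇒σ*[σ*k]≤32*k k (s≤s⁻¹ σ<4))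
  where
  open Staircase σ k
  open StepSquares 2≤σ
... | no σ≮4 = blockSquares , blockSquares-unique , blockSquares-OPSquareIn ,
               subst (λ n → σ * (σ * k) ≤ 32 * n) (sym length-blockSquares) (σ≤8q⇒σ*[σ*k]≤32*[q*[qk+qk]] {q} k σ≤8q)
  where
  q : ℕ
  q = σ / 4
  4q≤σ : 4 * q ≤ σ
  4q≤σ = proj₁ (quarter-bounds σ (≮⇒≥ σ≮4))
  σ≤8q : σ ≤ 8 * q
  σ≤8q = proj₂ (quarter-bounds σ (≮⇒≥ σ≮4))
  open Staircase σ k
  open BlockSquares q (q * k + q * k) (4q≤σ⇒4qk≤σk {q} k 4q≤σ)

theorem4 : Σ ℕ λ a → Σ ℕ λ b → (1 ≤ a) × (1 ≤ b) ×
    (∀ (σ : ℕ) → 2 ≤ σ → ∀ (N : ℕ) →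
      Σ ℕ λ k → Σ (Word σ) λ s →
        (length s ≡ k * σ) × (N ≤ length s) ×
        (Σ (List (Word σ)) λ L →
          Unique L × All (λ w → OPSquare w × Fragment w s) L ×
          (a * (σ * length s) ≤ b * length L)))
theorem4 = 1 , 32 , s≤s z≤n , s≤s z≤n , λ where
  zero ()
  σ@(suc _) 2≤σ N →
    let k = suc N
        open Staircase σ k
        |s|≡σk = length-window letter 0 (σ * k)
        L , unique , squares , σ²k≤32|L| = staircase-opSquares σ k 2≤σ
    in k , staircase , trans |s|≡σk (*-comm σ k) ,
       subst (N ≤_) (sym |s|≡σk) (≤-trans (n≤1+n N) (m≤n*m k σ)) ,
       L , unique , squares ,
       subst (λ n → 1 * (σ * n) ≤ 32 * length L) (sym |s|≡σk)
             (subst (_≤ 32 * length L) (sym (*-identityˡ _)) σ²k≤32|L|)
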